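{- For every integer $n\geq 5$, $\chi_\delta(C_n\square P_3)=2\chi_\delta(C_n)=2\left\lceil\frac{n}{2}\right\rceil$.
   Context: All graphs are finite and simple; $C_n$ is the cycle on $n$ vertices and $P_3$ the path on 3 vertices; $d_G(x)$ denotes the degree of $x$ in $G$. The $\delta$-complement $G_\delta$ of a graph $G$ is the graph on $V(G)$ in which distinct $u,v$ are adjacent iff either ($d_G(u)=d_G(v)$ and $uv\notin E(G)$) or ($d_G(u)\neq d_G(v)$ and $uv\in E(G)$). The $\delta$-chromatic number $\chi_\delta(G)$ is the chromatic number of $G_\delta$. The Cartesian product $G\square H$ has vertex set $V(G)\times V(H)$, with $(x,y)$ adjacent to $(x',y')$ iff either $x=x'$ and $yy'\in E(H)$, or $y=y'$ and $xx'\in E(G)$. -}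

module Defs where

open import Data.Nat using (ℕ; zero; suc; _*_; _∸_; _≡ᵇ_; _≤_)
open import Data.Bool using (Bool; true; false; _∧_; _∨_; not; if_then_else_)
open import Data.Fin using (Fin; toℕ; remQuot)
open import Data.List using (List; length; filterᵇ; allFin)
open import Data.Product using (_×_; Σ; _,_; proj₁; proj₂)
open import Relation.Binary.PropositionalEquality using (_≡_; _≢_)

-- A finite simple graph on vertex set Fin n is represented by its Boolean
-- adjacency function Fin n → Fin n → Bool (the concrete graphs below are
-- symmetric and irreflexive).
Adj : ℕ → Set
Adj n = Fin n → Fin n → Bool

finEq : ∀ {n} → Fin n → Fin n → Bool
finEq i j = toℕ i ≡ᵇ toℕ j

deg : ∀ {n} → Adj n → Fin n → ℕ
deg {n} G u = length (filterᵇ (G u) (allFin n))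

δadj : ∀ {n} → Adj n → Adj n
δadj G u v =
  not (finEq u v) ∧
  (if deg G u ≡ᵇ deg G v then not (G u v) else G u v)

ProperColouring : (n : ℕ) → (Fin n → Fin n → Bool) → (k : ℕ) → Set
ProperColouring n a k =
  Σ (Fin n → Fin k) λ c → ∀ u v → a u v ≡ true → c u ≢ c v

IsChromaticNumber : (n : ℕ) → (Fin n → Fin n → Bool) → ℕ → Set
IsChromaticNumber n a k =
  ProperColouring n a k × (∀ m → ProperColouring n a m → k ≤ m)

IsDeltaChromaticNumber : (n : ℕ) → Adj n → ℕ → Set
IsDeltaChromaticNumber n G k = IsChromaticNumber n (δadj G) k

-- Cycle C_n on vertices 0..n-1 (a simple graph for n ≥ 3).
cycleAdjℕ : ℕ → ℕ → ℕ → Bool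
cycleAdjℕ n i j =
  (suc i ≡ᵇ j) ∨ (suc j ≡ᵇ i) ∨
  ((i ≡ᵇ 0) ∧ (j ≡ᵇ n ∸ 1)) ∨ ((j ≡ᵇ 0) ∧ (i ≡ᵇ n ∸ 1))

pathAdjℕ : ℕ → ℕ → Bool
pathAdjℕ i j = (suc i ≡ᵇ j) ∨ (suc j ≡ᵇ i)

boxAdj : (m k : ℕ) → (Fin m → Fin m → Bool) → (Fin k → Fin k → Bool)
       → Fin (m * k) → Fin (m * k) → Bool
boxAdj m k a b p q =
  let x = proj₁ (remQuot {m} k p) ; y = proj₂ (remQuot {m} k p)
      x' = proj₁ (remQuot {m} k q) ; y' = proj₂ (remQuot {m} k q)
  in (finEq x x' ∧ b y y') ∨ (finEq y y' ∧ a x x')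

cycleG : (n : ℕ) → Adj n
cycleG n i j = cycleAdjℕ n (toℕ i) (toℕ j)

pathP3 : Adj 3
pathP3 i j = pathAdjℕ (toℕ i) (toℕ j)

cycleBoxP3 : (n : ℕ) → Adj (n * 3)
cycleBoxP3 n = boxAdj n 3 (cycleG n) pathP3

-- δ-complements only see degrees. C_n is 2-regular, so its δ-complement is its ordinary complement, whose
-- colour classes are cliques of C_n: pairing 2i with 2i+1 gives a colouring with ⌈n/2⌉ colours, and the
-- vertices {0,2,4,…} — or, when 0 and n−1 share a colour, {0,1,3,5,…} — must all receive distinct colours.
-- In C_n □ P_3 the outer layers have degree 3 and the middle layer degree 4. So each layer induces the
-- complement of C_n, the two outer layers are completely joined to each other (whence 2⌈n/2⌉ colours are
-- needed), and a middle vertex is joined only to its two copies in the outer layers: the middle layer can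
-- reuse the pair colours of the first layer after a fixed-point-free rotation of the pairs.
module Submission where

open import Data.Bool using (Bool; true; false; _∧_; _∨_; not)
open import Data.Bool.Properties using (T-≡; ∧-zeroʳ; ∨-zeroʳ; ∧-conicalˡ; ∧-conicalʳ)
open import Data.Empty using (⊥)
open import Data.Fin as F using (Fin; zero; suc; toℕ; fromℕ<; combine; remQuot; _↑ˡ_; _↑ʳ_)
open import Data.Fin.Patterns using (0F; 1F; 2F)
open import Data.Fin.Properties
  using (toℕ<n; toℕ-injective; toℕ-fromℕ<; fromℕ<-cong; fromℕ<-injective; injective⇒≤; join-splitAt;
         remQuot-combine; combine-remQuot; combine-injectiveˡ; combine-injectiveʳ)
open import Data.List using (length; filterᵇ; tabulate)
open import Data.Nat using (ℕ; zero; suc; _+_; _*_; _∸_; _≡ᵇ_; _≤_; _<_; z≤n; s≤s; z<s; ⌊_/2⌋; ⌈_/2⌉)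
open import Data.Nat.Properties
  using (_≟_; ≡ᵇ⇒≡; ≡⇒≡ᵇ; suc-injective; +-assoc; +-comm; +-identityʳ; +-cancelˡ-≡; ≤-refl; ≤-trans;
         <-trans; ≤-<-trans; n≤1+n; n<1+n; m<n⇒m<1+n; ≤∧≢⇒<; <⇒≢; m≤m+n; +-monoʳ-<; m+n≮m; m∸n≤m;
         ⌊n/2⌋-mono; ⌈n/2⌉-mono; +-*-semiring)
open import Data.Product using (Σ-syntax; _×_; _,_; proj₁; proj₂; uncurry)
open import Data.Sum as Sum using (_⊎_; inj₁; inj₂; [_,_]′)
open import Function using (_∘_; id)
open import Function.Bundles using (Equivalence; _⇔_; mk⇔)
open import Function.Definitions using (Injective)
open import Relation.Binary.PropositionalEquality
  using (_≡_; _≢_; refl; sym; trans; cong; cong₂; subst; subst₂; module ≡-Reasoning)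
open import Relation.Nullary using (¬_; yes; no; contradiction)
open import Relation.Nullary.Decidable using (decidable-stable)
open import Algebra.Properties.Semiring.Sum +-*-semiring
  using (sum; sum-syntax; ∑-distrib-+; *-distribˡ-sum; sum-cong-≗; sum-replicate-zero)

open import Defs

𝟙 : Bool → ℕ
𝟙 true  = 1
𝟙 false = 0

𝟙-∧ : ∀ x y → 𝟙 (x ∧ y) ≡ 𝟙 x * 𝟙 y
𝟙-∧ false y     = refl
𝟙-∧ true  false = refl
𝟙-∧ true  true  = refl

𝟙-∨ : ∀ x y → (x ≡ true → y ≡ true → ⊥) → 𝟙 (x ∨ y) ≡ 𝟙 x + 𝟙 y
𝟙-∨ false y     _     = refl
𝟙-∨ true  false _     = refl
𝟙-∨ true  true  ¬both with () ← ¬both refl refl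

∨-true : ∀ x {y} → x ∨ y ≡ true → x ≡ true ⊎ y ≡ true
∨-true true  _ = inj₁ refl
∨-true false e = inj₂ e

∨-introˡ : ∀ {x} y → x ≡ true → x ∨ y ≡ true
∨-introˡ y refl = refl

∨-introʳ : ∀ x {y} → y ≡ true → x ∨ y ≡ true
∨-introʳ x refl = ∨-zeroʳ x

∧-intro : ∀ {x y} → x ≡ true → y ≡ true → x ∧ y ≡ true
∧-intro refl refl = refl

same-truth⇒≡ : ∀ {x y} → (x ≡ true ⇔ y ≡ true) → x ≡ y
same-truth⇒≡ {false} {false} _   = refl
same-truth⇒≡ {false} {true}  x⇔y = Equivalence.from x⇔y refl
same-truth⇒≡ {true}  {false} x⇔y = sym (Equivalence.to x⇔y refl)
same-truth⇒≡ {true}  {true}  _   = refl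

≡ᵇ-true⇒≡ : ∀ {m n} → (m ≡ᵇ n) ≡ true → m ≡ n
≡ᵇ-true⇒≡ {m} {n} e = ≡ᵇ⇒≡ m n (Equivalence.from T-≡ e)

≡⇒≡ᵇ-true : ∀ {m n} → m ≡ n → (m ≡ᵇ n) ≡ true
≡⇒≡ᵇ-true {m} {n} e = Equivalence.to T-≡ (≡⇒≡ᵇ m n e)

≢⇒≡ᵇ-false : ∀ {m n} → m ≢ n → (m ≡ᵇ n) ≡ false
≢⇒≡ᵇ-false {m} {n} m≢n with m ≡ᵇ n in e
... | true  = contradiction (≡ᵇ-true⇒≡ e) m≢n
... | false = refl

finEq-sound : ∀ {n} {u v : Fin n} → finEq u v ≡ true → u ≡ v
finEq-sound e = toℕ-injective (≡ᵇ-true⇒≡ e)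

finEq-refl : ∀ {n} (u : Fin n) → finEq u u ≡ true
finEq-refl u = ≡⇒≡ᵇ-true {toℕ u} refl

finEq-≢ : ∀ {n} {u v : Fin n} → u ≢ v → finEq u v ≡ false
finEq-≢ u≢v = ≢⇒≡ᵇ-false (u≢v ∘ toℕ-injective)

-- Degrees as sums

length-filterᵇ-tabulate : ∀ {n} {A : Set} (p : A → Bool) (f : Fin n → A) →
  length (filterᵇ p (tabulate f)) ≡ ∑[ i < n ] 𝟙 (p (f i))
length-filterᵇ-tabulate {zero}  p f = refl
length-filterᵇ-tabulate {suc n} p f with p (f zero)
... | true  = cong suc (length-filterᵇ-tabulate p (f ∘ suc))
... | false = length-filterᵇ-tabulate p (f ∘ suc)

deg≡∑ : ∀ {n} (G : Adj n) u → deg G u ≡ ∑[ v < n ] 𝟙 (G u v)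
deg≡∑ G u = length-filterᵇ-tabulate (G u) id

∑-𝟙-≡ᵇ : ∀ {n} b → b < n → ∑[ j < n ] 𝟙 (b ≡ᵇ toℕ j) ≡ 1
∑-𝟙-≡ᵇ {suc n} zero    _         = cong suc (sum-replicate-zero n)
∑-𝟙-≡ᵇ {suc n} (suc b) (s≤s b<n) = ∑-𝟙-≡ᵇ b b<n

∑-sift : ∀ {n} (x : Fin n) (f : Fin n → ℕ) → ∑[ j < n ] (𝟙 (finEq x j) * f j) ≡ f x
∑-sift {suc n} zero    f =
  trans (cong₂ _+_ (+-identityʳ (f zero)) (sum-replicate-zero n)) (+-identityʳ (f zero))
∑-sift {suc n} (suc x) f = ∑-sift x (f ∘ suc)

∑-↑ : ∀ a {b} (f : Fin (a + b) → ℕ) →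
  ∑[ i < a + b ] f i ≡ ∑[ i < a ] f (i ↑ˡ b) + ∑[ j < b ] f (a ↑ʳ j)
∑-↑ zero    f = refl
∑-↑ (suc a) f = trans (cong (f zero +_) (∑-↑ a (f ∘ suc))) (sym (+-assoc (f zero) _ _))

∑-combine : ∀ m {k} (f : Fin (m * k) → ℕ) →
  ∑[ p < m * k ] f p ≡ ∑[ i < m ] ∑[ j < k ] f (combine i j)
∑-combine zero        f = refl
∑-combine (suc m) {k} f =
  trans (∑-↑ k f) (cong (∑[ j < k ] f (j ↑ˡ m * k) +_) (∑-combine m (f ∘ (k ↑ʳ_))))

-- Cartesian products

boxAdj-combine : ∀ {m k} (a : Adj m) (b : Adj k) x y x′ y′ →
  boxAdj m k a b (combine x y) (combine x′ y′) ≡ (finEq x x′ ∧ b y y′) ∨ (finEq y y′ ∧ a x x′)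
boxAdj-combine {m} {k} a b x y x′ y′ =
  cong₂ onPairs (remQuot-combine {m} {k} x y) (remQuot-combine {m} {k} x′ y′)
  where
  onPairs : Fin m × Fin k → Fin m × Fin k → Bool
  onPairs (x , y) (x′ , y′) = (finEq x x′ ∧ b y y′) ∨ (finEq y y′ ∧ a x x′)

∀-combine : ∀ {m k} {P : Fin (m * k) → Fin (m * k) → Set} →
  (∀ (x : Fin m) (y : Fin k) x′ y′ → P (combine x y) (combine x′ y′)) → ∀ p q → P p q
∀-combine {m} {k} {P} h p q = subst₂ P (combine-remQuot {m} k p) (combine-remQuot {m} k q)
  (h (proj₁ (remQuot {m} k p)) (proj₂ (remQuot {m} k p))
     (proj₁ (remQuot {m} k q)) (proj₂ (remQuot {m} k q)))

-- Only the second factor needs to be loopless: a loop of the first is counted once on either side.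
deg-boxAdj : ∀ {m k} (a : Adj m) (b : Adj k) → (∀ y → b y y ≡ false) →
  ∀ x y → deg (boxAdj m k a b) (combine x y) ≡ deg a x + deg b y
deg-boxAdj {m} {k} a b b-irrefl x y = begin
  deg (boxAdj m k a b) (combine x y)
    ≡⟨ deg≡∑ (boxAdj m k a b) (combine x y) ⟩
  ∑[ p < m * k ] 𝟙 (boxAdj m k a b (combine x y) p)
    ≡⟨ ∑-combine m (λ p → 𝟙 (boxAdj m k a b (combine x y) p)) ⟩
  ∑[ i < m ] ∑[ j < k ] 𝟙 (boxAdj m k a b (combine x y) (combine i j))
    ≡⟨ sum-cong-≗ (λ i → sum-cong-≗ (𝟙-boxAdj i)) ⟩
  ∑[ i < m ] ∑[ j < k ] (columnEdge i j + layerEdge i j)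
    ≡⟨ sum-cong-≗ (λ i → ∑-distrib-+ (columnEdge i) (layerEdge i)) ⟩
  ∑[ i < m ] (∑[ j < k ] columnEdge i j + ∑[ j < k ] layerEdge i j)
    ≡⟨ ∑-distrib-+ (λ i → sum (columnEdge i)) (λ i → sum (layerEdge i)) ⟩
  ∑[ i < m ] ∑[ j < k ] columnEdge i j + ∑[ i < m ] ∑[ j < k ] layerEdge i j
    ≡⟨ cong₂ _+_ (trans (sum-cong-≗ (λ i → sym (*-distribˡ-sum (𝟙 (finEq x i)) (𝟙 ∘ b y))))
                        (∑-sift x (λ _ → ∑b)))
                 (sum-cong-≗ (λ i → ∑-sift y (λ _ → 𝟙 (a x i)))) ⟩
  ∑b + ∑a
    ≡⟨ +-comm ∑b ∑a ⟩
  ∑a + ∑b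
    ≡⟨ cong₂ _+_ (deg≡∑ a x) (deg≡∑ b y) ⟨
  deg a x + deg b y ∎
  where
  open ≡-Reasoning
  ∑a ∑b : ℕ
  ∑a = ∑[ i < m ] 𝟙 (a x i)
  ∑b = ∑[ j < k ] 𝟙 (b y j)
  columnEdge layerEdge : Fin m → Fin k → ℕ
  columnEdge i j = 𝟙 (finEq x i) * 𝟙 (b y j)
  layerEdge  i j = 𝟙 (finEq y j) * 𝟙 (a x i)
  𝟙-boxAdj : ∀ i j → 𝟙 (boxAdj m k a b (combine x y) (combine i j)) ≡ columnEdge i j + layerEdge i j
  𝟙-boxAdj i j = begin
    𝟙 (boxAdj m k a b (combine x y) (combine i j))
      ≡⟨ cong 𝟙 (boxAdj-combine a b x y i j) ⟩
    𝟙 ((finEq x i ∧ b y j) ∨ (finEq y j ∧ a x i))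
      ≡⟨ 𝟙-∨ _ _ disjoint ⟩
    𝟙 (finEq x i ∧ b y j) + 𝟙 (finEq y j ∧ a x i)
      ≡⟨ cong₂ _+_ (𝟙-∧ (finEq x i) (b y j)) (𝟙-∧ (finEq y j) (a x i)) ⟩
    columnEdge i j + layerEdge i j ∎
    where
    disjoint : finEq x i ∧ b y j ≡ true → finEq y j ∧ a x i ≡ true → ⊥
    disjoint e₁ e₂ with refl ← finEq-sound {u = y} {j} (∧-conicalˡ _ _ e₂)
      with () ← trans (sym (b-irrefl y)) (∧-conicalʳ (finEq x i) _ e₁)

boxAdj-sameLayer : ∀ {m k} (a : Adj m) (b : Adj k) → (∀ y → b y y ≡ false) →
  ∀ x x′ y → boxAdj m k a b (combine x y) (combine x′ y) ≡ a x x′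
boxAdj-sameLayer a b b-irrefl x x′ y
  rewrite boxAdj-combine a b x y x′ y | b-irrefl y | finEq-refl y | ∧-zeroʳ (finEq x x′) = refl

boxAdj-apart : ∀ {m k} (a : Adj m) (b : Adj k) {x x′ y y′} → y ≢ y′ → finEq x x′ ∧ b y y′ ≡ false →
  boxAdj m k a b (combine x y) (combine x′ y′) ≡ false
boxAdj-apart a b {x} {x′} {y} {y′} y≢y′ e rewrite boxAdj-combine a b x y x′ y′ | e | finEq-≢ y≢y′ = refl

-- δ-complements

module _ {n} (G : Adj n) {u v : Fin n} where

  δadj-sameDeg : deg G u ≡ deg G v → δadj G u v ≡ not (finEq u v) ∧ not (G u v)
  δadj-sameDeg d rewrite ≡⇒≡ᵇ-true d = refl

  δadj-diffDeg : deg G u ≢ deg G v → δadj G u v ≡ not (finEq u v) ∧ G u v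
  δadj-diffDeg d rewrite ≢⇒≡ᵇ-false d = refl

  δadj-merged : deg G u ≡ deg G v → u ≡ v ⊎ G u v ≡ true → δadj G u v ≡ false
  δadj-merged _ (inj₁ refl) rewrite finEq-refl u = refl
  δadj-merged d (inj₂ e)    rewrite δadj-sameDeg d | e = ∧-zeroʳ _

  δadj-diffDeg-nonadjacent : deg G u ≢ deg G v → G u v ≡ false → δadj G u v ≡ false
  δadj-diffDeg-nonadjacent d e rewrite δadj-diffDeg d | e = ∧-zeroʳ _

  δadj-sameDeg-nonadjacent : deg G u ≡ deg G v → u ≢ v → G u v ≡ false → δadj G u v ≡ true
  δadj-sameDeg-nonadjacent d u≢v e rewrite δadj-sameDeg d | finEq-≢ u≢v | e = refl

colouring-from : ∀ {n k} {a : Adj n} (c : Fin n → Fin k) →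
  (∀ u v → c u ≡ c v → a u v ≡ false) → ProperColouring n a k
colouring-from c merge = c , λ u v adj same → contradiction (trans (sym adj) (merge u v same)) λ ()

disjoint-injections⇒≤ : ∀ {a b m} {f : Fin a → Fin m} {g : Fin b → Fin m} →
  Injective _≡_ _≡_ f → Injective _≡_ _≡_ g → (∀ i j → f i ≢ g j) → a + b ≤ m
disjoint-injections⇒≤ {a} {b} {f = f} {g} f-inj g-inj disjoint =
  injective⇒≤ {f = [ f , g ]′ ∘ F.splitAt a} injective
  where
  [f,g]-injective : Injective _≡_ _≡_ [ f , g ]′
  [f,g]-injective {inj₁ i} {inj₁ j} e = cong inj₁ (f-inj e)
  [f,g]-injective {inj₁ i} {inj₂ j} e = contradiction e (disjoint i j)
  [f,g]-injective {inj₂ i} {inj₁ j} e = contradiction (sym e) (disjoint j i)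
  [f,g]-injective {inj₂ i} {inj₂ j} e = cong inj₂ (g-inj e)
  injective : Injective _≡_ _≡_ ([ f , g ]′ ∘ F.splitAt a)
  injective {i} {j} e = trans (sym (join-splitAt a b i))
    (trans (cong (F.join a b) ([f,g]-injective {F.splitAt a i} {F.splitAt a j} e)) (join-splitAt a b j))

-- The cycle C_n

data CycleEdge (n i j : ℕ) : Set where
  succ  : suc i ≡ j → CycleEdge n i j
  pred  : suc j ≡ i → CycleEdge n i j
  wrapˡ : i ≡ 0 → j ≡ n ∸ 1 → CycleEdge n i j
  wrapʳ : j ≡ 0 → i ≡ n ∸ 1 → CycleEdge n i j

module _ (n i j : ℕ) where

  private
    s p wˡ wʳ : Bool
    s  = suc i ≡ᵇ j
    p  = suc j ≡ᵇ i
    wˡ = (i ≡ᵇ 0) ∧ (j ≡ᵇ n ∸ 1)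
    wʳ = (j ≡ᵇ 0) ∧ (i ≡ᵇ n ∸ 1)

  cycleAdjℕ-sound : cycleAdjℕ n i j ≡ true → CycleEdge n i j
  cycleAdjℕ-sound e with ∨-true s e
  ... | inj₁ eₛ = succ (≡ᵇ-true⇒≡ eₛ)
  ... | inj₂ e with ∨-true p e
  ... | inj₁ eₚ = pred (≡ᵇ-true⇒≡ eₚ)
  ... | inj₂ e with ∨-true wˡ e
  ... | inj₁ eˡ = wrapˡ (≡ᵇ-true⇒≡ (∧-conicalˡ _ _ eˡ)) (≡ᵇ-true⇒≡ (∧-conicalʳ _ _ eˡ))
  ... | inj₂ eʳ = wrapʳ (≡ᵇ-true⇒≡ (∧-conicalˡ _ _ eʳ)) (≡ᵇ-true⇒≡ (∧-conicalʳ _ _ eʳ))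

  cycleAdjℕ-complete : CycleEdge n i j → cycleAdjℕ n i j ≡ true
  cycleAdjℕ-complete (succ e)      = ∨-introˡ (p ∨ wˡ ∨ wʳ) (≡⇒≡ᵇ-true e)
  cycleAdjℕ-complete (pred e)      = ∨-introʳ s (∨-introˡ (wˡ ∨ wʳ) (≡⇒≡ᵇ-true e))
  cycleAdjℕ-complete (wrapˡ e₁ e₂) =
    ∨-introʳ s (∨-introʳ p (∨-introˡ wʳ (∧-intro (≡⇒≡ᵇ-true e₁) (≡⇒≡ᵇ-true e₂))))
  cycleAdjℕ-complete (wrapʳ e₁ e₂) =
    ∨-introʳ s (∨-introʳ p (∨-introʳ wˡ (∧-intro (≡⇒≡ᵇ-true e₁) (≡⇒≡ᵇ-true e₂))))

  cycleAdjℕ-false : ¬ CycleEdge n i j → cycleAdjℕ n i j ≡ false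
  cycleAdjℕ-false ¬edge with cycleAdjℕ n i j in e
  ... | true  = contradiction (cycleAdjℕ-sound e) ¬edge
  ... | false = refl

record CycleNeighbours (n a : ℕ) : Set where
  field
    left right : ℕ
    left<n     : left < n
    right<n    : right < n
    left≢right : left ≢ right
    edge⇔      : ∀ {j} → j < n → CycleEdge n a j ⇔ (left ≡ j ⊎ right ≡ j)

cycleNeighbours : ∀ {n a} → 3 ≤ n → a < n → CycleNeighbours n a
cycleNeighbours {n@(suc (suc (suc _)))} {zero} (s≤s (s≤s (s≤s _))) _ = record
  { left = 1 ; right = n ∸ 1 ; left<n = s≤s (s≤s z≤n) ; right<n = ≤-refl
  ; left≢right = λ () ; edge⇔ = λ _ → mk⇔ to from }
  where
  to : ∀ {j} → CycleEdge n 0 j → 1 ≡ j ⊎ n ∸ 1 ≡ j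
  to (succ e)    = inj₁ e
  to (wrapˡ _ e) = inj₂ (sym e)
  to (wrapʳ _ ())
  from : ∀ {j} → 1 ≡ j ⊎ n ∸ 1 ≡ j → CycleEdge n 0 j
  from (inj₁ e) = succ e
  from (inj₂ e) = wrapˡ refl (sym e)
cycleNeighbours {n@(suc (suc (suc _)))} {suc a} (s≤s (s≤s (s≤s _))) a<n with suc (suc a) ≟ n
... | yes last = record
  { left = a ; right = 0 ; left<n = <-trans (n<1+n a) a<n ; right<n = z<s
  ; left≢right = λ { refl → contradiction last λ () } ; edge⇔ = λ j<n → mk⇔ (to j<n) from }
  where
  to : ∀ {j} → j < n → CycleEdge n (suc a) j → a ≡ j ⊎ 0 ≡ j
  to j<n (succ refl) = contradiction last (<⇒≢ j<n)
  to _   (pred e)    = inj₁ (sym (suc-injective e))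
  to _   (wrapʳ e _) = inj₂ (sym e)
  from : ∀ {j} → a ≡ j ⊎ 0 ≡ j → CycleEdge n (suc a) j
  from (inj₁ refl) = pred refl
  from (inj₂ refl) = wrapʳ refl (cong (_∸ 1) last)
... | no ¬last = record
  { left = a ; right = suc (suc a) ; left<n = <-trans (n<1+n a) a<n ; right<n = ≤∧≢⇒< a<n ¬last
  ; left≢right = <⇒≢ (m<n⇒m<1+n (n<1+n a)) ; edge⇔ = λ _ → mk⇔ to from }
  where
  to : ∀ {j} → CycleEdge n (suc a) j → a ≡ j ⊎ suc (suc a) ≡ j
  to (succ e)    = inj₂ e
  to (pred e)    = inj₁ (sym (suc-injective e))
  to (wrapʳ _ e) = contradiction (cong suc e) ¬last
  from : ∀ {j} → a ≡ j ⊎ suc (suc a) ≡ j → CycleEdge n (suc a) j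
  from (inj₁ refl) = pred refl
  from (inj₂ e)    = succ e

deg-cycleG : ∀ {n} → 3 ≤ n → ∀ x → deg (cycleG n) x ≡ 2
deg-cycleG {n} 3≤n x = begin
  deg (cycleG n) x
    ≡⟨ deg≡∑ (cycleG n) x ⟩
  ∑[ j < n ] 𝟙 (cycleG n x j)
    ≡⟨ sum-cong-≗ 𝟙-neighbourhood ⟩
  ∑[ j < n ] (𝟙 (left ≡ᵇ toℕ j) + 𝟙 (right ≡ᵇ toℕ j))
    ≡⟨ ∑-distrib-+ {n} (𝟙 ∘ (left ≡ᵇ_) ∘ toℕ) (𝟙 ∘ (right ≡ᵇ_) ∘ toℕ) ⟩
  ∑[ j < n ] 𝟙 (left ≡ᵇ toℕ j) + ∑[ j < n ] 𝟙 (right ≡ᵇ toℕ j)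
    ≡⟨ cong₂ _+_ (∑-𝟙-≡ᵇ left left<n) (∑-𝟙-≡ᵇ right right<n) ⟩
  2 ∎
  where
  open ≡-Reasoning
  open CycleNeighbours (cycleNeighbours 3≤n (toℕ<n x))
  neighbourhood : ∀ j → cycleG n x j ≡ (left ≡ᵇ toℕ j) ∨ (right ≡ᵇ toℕ j)
  neighbourhood j = same-truth⇒≡ (mk⇔
    (λ adj → [ ∨-introˡ _ ∘ ≡⇒≡ᵇ-true , ∨-introʳ _ ∘ ≡⇒≡ᵇ-true ]′
               (Equivalence.to (edge⇔ (toℕ<n j)) (cycleAdjℕ-sound n _ _ adj)))
    (λ adj → cycleAdjℕ-complete n _ _ (Equivalence.from (edge⇔ (toℕ<n j))
               (Sum.map ≡ᵇ-true⇒≡ ≡ᵇ-true⇒≡ (∨-true _ adj)))))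
  𝟙-neighbourhood : ∀ j → 𝟙 (cycleG n x j) ≡ 𝟙 (left ≡ᵇ toℕ j) + 𝟙 (right ≡ᵇ toℕ j)
  𝟙-neighbourhood j = trans (cong 𝟙 (neighbourhood j))
    (𝟙-∨ _ _ (λ e₁ e₂ → left≢right (trans (≡ᵇ-true⇒≡ e₁) (sym (≡ᵇ-true⇒≡ e₂)))))

deg-cycleG-equal : ∀ {n} → 3 ≤ n → ∀ x y → deg (cycleG n) x ≡ deg (cycleG n) y
deg-cycleG-equal 3≤n x y = trans (deg-cycleG 3≤n x) (sym (deg-cycleG 3≤n y))

⌊/2⌋<⌈/2⌉ : ∀ {a n} → a < n → ⌊ a /2⌋ < ⌈ n /2⌉
⌊/2⌋<⌈/2⌉ a<n = ⌊n/2⌋-mono (s≤s a<n)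

sameHalf : ∀ a b → ⌊ a /2⌋ ≡ ⌊ b /2⌋ → a ≡ b ⊎ suc a ≡ b ⊎ suc b ≡ a
sameHalf 0 0 _ = inj₁ refl
sameHalf 0 1 _ = inj₂ (inj₁ refl)
sameHalf 1 0 _ = inj₂ (inj₂ refl)
sameHalf 1 1 _ = inj₁ refl
sameHalf (suc (suc a)) (suc (suc b)) e =
  Sum.map (cong (2 +_)) (Sum.map (cong (2 +_)) (cong (2 +_))) (sameHalf a b (suc-injective e))

sameHalf⇒≡⊎adjacent : ∀ {n} (x y : Fin n) → ⌊ toℕ x /2⌋ ≡ ⌊ toℕ y /2⌋ → x ≡ y ⊎ cycleG n x y ≡ true
sameHalf⇒≡⊎adjacent {n} x y e with sameHalf (toℕ x) (toℕ y) e
... | inj₁ x≡y        = inj₁ (toℕ-injective x≡y)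
... | inj₂ (inj₁ x→y) = inj₂ (cycleAdjℕ-complete n _ _ (succ x→y))
... | inj₂ (inj₂ y→x) = inj₂ (cycleAdjℕ-complete n _ _ (pred y→x))

halfColouring : ∀ {n} → Fin n → Fin ⌈ n /2⌉
halfColouring x = fromℕ< (⌊/2⌋<⌈/2⌉ (toℕ<n x))

cycleG-δColouring : ∀ {n} → 3 ≤ n → ProperColouring n (δadj (cycleG n)) ⌈ n /2⌉
cycleG-δColouring {n} 3≤n = colouring-from halfColouring λ x y same →
  δadj-merged (cycleG n) (deg-cycleG-equal 3≤n x y)
    (sameHalf⇒≡⊎adjacent x y (fromℕ<-injective _ _ _ _ same))

double : ℕ → ℕ
double zero    = zero
double (suc a) = suc (suc (double a))

⌊double/2⌋ : ∀ a → ⌊ double a /2⌋ ≡ a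
⌊double/2⌋ zero    = refl
⌊double/2⌋ (suc a) = cong suc (⌊double/2⌋ a)

double-injective : ∀ {a b} → double a ≡ double b → a ≡ b
double-injective {a} {b} e = trans (sym (⌊double/2⌋ a)) (trans (cong ⌊_/2⌋ e) (⌊double/2⌋ b))

double≢suc-double : ∀ a b → double a ≢ suc (double b)
double≢suc-double (suc a) zero    ()
double≢suc-double (suc a) (suc b) e = double≢suc-double a b (suc-injective (suc-injective e))

double<n : ∀ {a} n → a < ⌈ n /2⌉ → double a < n
double<n {zero}  (suc n)       _         = z<s
double<n {suc a} (suc (suc n)) (s≤s a<k) = s≤s (s≤s (double<n n a<k))

double∸1-injective : ∀ {a b} → double a ∸ 1 ≡ double b ∸ 1 → a ≡ b
double∸1-injective {zero}  {zero}  _ = refl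
double∸1-injective {suc a} {suc b} e = cong suc (double-injective (suc-injective e))

double∸1-succ : ∀ a b → suc (double a ∸ 1) ≡ double b ∸ 1 → a ≡ 0 × b ≡ 1
double∸1-succ zero    (suc zero) _ = refl , refl
double∸1-succ (suc a) (suc b)    e = contradiction (suc-injective e) (double≢suc-double b a ∘ sym)

double∸1≢last : ∀ {b n} → 2 ≤ n → double b < n → double b ∸ 1 ≢ n ∸ 1
double∸1≢last {zero}  {suc zero}    (s≤s ()) _ _
double∸1≢last {zero}  {suc (suc n)} _ _ ()
double∸1≢last {suc b} {suc n}       _ b<n e = <⇒≢ b<n (cong suc e)

pred<self : ∀ {n} → 0 < n → n ∸ 1 < n
pred<self {suc n} _ = ≤-refl

1-last-separated : ∀ {n} → 4 ≤ n → 1 ≢ n ∸ 1 × ¬ CycleEdge n 1 (n ∸ 1)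
1-last-separated (s≤s (s≤s (s≤s (s≤s _)))) = (λ ()) , λ { (succ ()) ; (pred ()) }

module _ {n m} (4≤n : 4 ≤ n) (c : Fin n → Fin m)
         (proper : ∀ x y → x ≢ y → cycleG n x y ≡ false → c x ≢ c y) where

  private
    k : ℕ
    k = ⌈ n /2⌉

    colourAt : ∀ {a} → a < n → Fin m
    colourAt a<n = c (fromℕ< a<n)

    colourAt-cong : ∀ {a b} → a ≡ b → (a<n : a < n) (b<n : b < n) → colourAt a<n ≡ colourAt b<n
    colourAt-cong {a} {b} e a<n b<n = cong c (fromℕ<-cong a b e a<n b<n)

    colourAt-separates : ∀ {a b} (a<n : a < n) (b<n : b < n) →
      a ≢ b → ¬ CycleEdge n a b → colourAt a<n ≢ colourAt b<n
    colourAt-separates {a} {b} a<n b<n a≢b ¬edge = proper _ _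
      (λ e → a≢b (trans (sym (toℕ-fromℕ< a<n)) (trans (cong toℕ e) (toℕ-fromℕ< b<n))))
      (subst₂ (λ i j → cycleAdjℕ n i j ≡ false) (sym (toℕ-fromℕ< a<n)) (sym (toℕ-fromℕ< b<n))
        (cycleAdjℕ-false n a b ¬edge))

    rainbow : (f : ℕ → ℕ) (f< : ∀ {a} → a < k → f a < n) →
      (∀ {a b} (a<k : a < k) (b<k : b < k) → a ≢ b → colourAt (f< a<k) ≡ colourAt (f< b<k) →
         f a ≢ f b × ¬ CycleEdge n (f a) (f b)) →
      Σ[ s ∈ (Fin k → Fin n) ] Injective _≡_ _≡_ (c ∘ s)
    rainbow f f< separated = s , injective
      where
      s : Fin k → Fin n
      s i = fromℕ< (f< (toℕ<n i))
      injective : Injective _≡_ _≡_ (c ∘ s)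
      injective {i} {j} same = decidable-stable (i F.≟ j) λ i≢j →
        let (fi≢fj , ¬edge) = separated (toℕ<n i) (toℕ<n j) (i≢j ∘ toℕ-injective) same
        in colourAt-separates (f< (toℕ<n i)) (f< (toℕ<n j)) fi≢fj ¬edge same

    0<n : 0 < n
    0<n = ≤-trans (s≤s z≤n) 4≤n

    1<n : 1 < n
    1<n = ≤-trans (s≤s (s≤s z≤n)) 4≤n

    last<n : n ∸ 1 < n
    last<n = pred<self 0<n

    evens : colourAt 0<n ≢ colourAt last<n → Σ[ s ∈ (Fin k → Fin n) ] Injective _≡_ _≡_ (c ∘ s)
    evens c₀≢cₗ = rainbow double (double<n n) separated
      where
      separated : ∀ {a b} (a<k : a < k) (b<k : b < k) → a ≢ b →
        colourAt (double<n n a<k) ≡ colourAt (double<n n b<k) →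
        double a ≢ double b × ¬ CycleEdge n (double a) (double b)
      separated {a} {b} a<k b<k a≢b same = a≢b ∘ double-injective , ¬edge
        where
        a<n : double a < n
        a<n = double<n n a<k
        b<n : double b < n
        b<n = double<n n b<k
        ¬edge : ¬ CycleEdge n (double a) (double b)
        ¬edge (succ e)      = double≢suc-double b a (sym e)
        ¬edge (pred e)      = double≢suc-double a b (sym e)
        ¬edge (wrapˡ e₁ e₂) =
          c₀≢cₗ (trans (colourAt-cong (sym e₁) 0<n a<n) (trans same (colourAt-cong e₂ b<n last<n)))
        ¬edge (wrapʳ e₁ e₂) =
          c₀≢cₗ (trans (colourAt-cong (sym e₁) 0<n b<n) (trans (sym same) (colourAt-cong e₂ a<n last<n)))

    odds : colourAt 0<n ≡ colourAt last<n → Σ[ s ∈ (Fin k → Fin n) ] Injective _≡_ _≡_ (c ∘ s)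
    odds c₀≡cₗ = rainbow f f< separated
      where
      f : ℕ → ℕ
      f a = double a ∸ 1
      f< : ∀ {a} → a < k → f a < n
      f< a<k = ≤-<-trans (m∸n≤m _ 1) (double<n n a<k)
      c₀≢c₁ : colourAt 0<n ≢ colourAt 1<n
      c₀≢c₁ c₀≡c₁ = let (1≢last , ¬edge) = 1-last-separated 4≤n in
        colourAt-separates 1<n last<n 1≢last ¬edge (trans (sym c₀≡c₁) c₀≡cₗ)
      separated : ∀ {a b} (a<k : a < k) (b<k : b < k) → a ≢ b →
        colourAt (f< a<k) ≡ colourAt (f< b<k) → f a ≢ f b × ¬ CycleEdge n (f a) (f b)
      separated {a} {b} a<k b<k a≢b same = a≢b ∘ double∸1-injective , ¬edge
        where
        ¬edge : ¬ CycleEdge n (f a) (f b)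
        ¬edge (succ e) = let (a≡0 , b≡1) = double∸1-succ a b e in
          c₀≢c₁ (trans (colourAt-cong (cong f (sym a≡0)) 0<n (f< a<k))
                  (trans same (colourAt-cong (cong f b≡1) (f< b<k) 1<n)))
        ¬edge (pred e) = let (b≡0 , a≡1) = double∸1-succ b a e in
          c₀≢c₁ (trans (colourAt-cong (cong f (sym b≡0)) 0<n (f< b<k))
                  (trans (sym same) (colourAt-cong (cong f a≡1) (f< a<k) 1<n)))
        ¬edge (wrapˡ _ e) = double∸1≢last (≤-trans (s≤s (s≤s z≤n)) 4≤n) (double<n n b<k) e
        ¬edge (wrapʳ _ e) = double∸1≢last (≤-trans (s≤s (s≤s z≤n)) 4≤n) (double<n n a<k) e

  cycleComplement-rainbow : Σ[ s ∈ (Fin ⌈ n /2⌉ → Fin n) ] Injective _≡_ _≡_ (c ∘ s)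
  cycleComplement-rainbow with colourAt 0<n F.≟ colourAt last<n
  ... | yes c₀≡cₗ = odds c₀≡cₗ
  ... | no  c₀≢cₗ = evens c₀≢cₗ

cycleG-δColours≥ : ∀ {n m} → 4 ≤ n → ProperColouring n (δadj (cycleG n)) m → ⌈ n /2⌉ ≤ m
cycleG-δColours≥ {n} 4≤n (c , proper) = injective⇒≤ (proj₂ (cycleComplement-rainbow 4≤n c
  λ x y x≢y nonadjacent → proper x y
    (δadj-sameDeg-nonadjacent (cycleG n) (deg-cycleG-equal (≤-trans (n≤1+n 3) 4≤n) x y) x≢y nonadjacent)))

-- The prism C_n □ P_3

pathP3-irrefl : ∀ y → pathP3 y y ≡ false
pathP3-irrefl 0F = refl
pathP3-irrefl 1F = refl
pathP3-irrefl 2F = refl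

deg-cycleBoxP3 : ∀ {n} → 3 ≤ n → ∀ x y → deg (cycleBoxP3 n) (combine x y) ≡ 2 + deg pathP3 y
deg-cycleBoxP3 {n} 3≤n x y =
  trans (deg-boxAdj (cycleG n) pathP3 pathP3-irrefl x y) (cong (_+ deg pathP3 y) (deg-cycleG 3≤n x))

deg-cycleBoxP3-cong : ∀ {n} → 3 ≤ n → ∀ x y x′ y′ → deg pathP3 y ≡ deg pathP3 y′ →
  deg (cycleBoxP3 n) (combine x y) ≡ deg (cycleBoxP3 n) (combine x′ y′)
deg-cycleBoxP3-cong 3≤n x y x′ y′ d =
  trans (deg-cycleBoxP3 3≤n x y) (trans (cong (2 +_) d) (sym (deg-cycleBoxP3 3≤n x′ y′)))

rotate : ℕ → ℕ → ℕ
rotate k zero    = k ∸ 1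
rotate k (suc i) = i

rotate-< : ∀ {k i} → i < k → rotate k i < k
rotate-< {suc k} {zero}  _         = ≤-refl
rotate-< {suc k} {suc i} (s≤s i<k) = m<n⇒m<1+n i<k

rotate-injective : ∀ {k i j} → i < k → j < k → rotate k i ≡ rotate k j → i ≡ j
rotate-injective {suc k} {zero}  {zero}  _ _ _ = refl
rotate-injective {suc k} {zero}  {suc j} _ (s≤s j<k) e = contradiction (sym e) (<⇒≢ j<k)
rotate-injective {suc k} {suc i} {zero}  (s≤s i<k) _ e = contradiction e (<⇒≢ i<k)
rotate-injective {suc k} {suc i} {suc j} _ _ e = cong suc e

rotate-≢ : ∀ {k} i → 2 ≤ k → rotate k i ≢ i
rotate-≢ zero    (s≤s (s≤s _)) ()
rotate-≢ (suc i) _             e = <⇒≢ (n<1+n i) e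

-- The colour of the vertex in layer y whose pair {2h, 2h+1} has index h.
layerColour : ℕ → Fin 3 → ℕ → ℕ
layerColour k 0F h = h
layerColour k 1F h = rotate k h
layerColour k 2F h = k + h

layerColour< : ∀ {k h} y → h < k → layerColour k y h < 2 * k
layerColour<     0F h<k = ≤-trans h<k (m≤m+n _ _)
layerColour<     1F h<k = ≤-trans (rotate-< h<k) (m≤m+n _ _)
layerColour< {k} 2F h<k = +-monoʳ-< k (≤-trans h<k (m≤m+n k 0))

module _ {n} (3≤n : 3 ≤ n) where

  private
    k : ℕ
    k = ⌈ n /2⌉

    G : Adj (n * 3)
    G = cycleBoxP3 n

    half : Fin n → ℕ
    half x = ⌊ toℕ x /2⌋

    half<k : ∀ x → half x < k
    half<k x = ⌊/2⌋<⌈/2⌉ (toℕ<n x)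

    colour : Fin n → Fin 3 → Fin (2 * k)
    colour x y = fromℕ< (layerColour< y (half<k x))

    sameLayer : ∀ {x x′} y → half x ≡ half x′ → δadj G (combine x y) (combine x′ y) ≡ false
    sameLayer {x} {x′} y e =
      δadj-merged G (deg-cycleBoxP3-cong 3≤n x y x′ y refl)
        (Sum.map (cong (λ z → combine z y))
                 (trans (boxAdj-sameLayer (cycleG n) pathP3 pathP3-irrefl x x′ y))
                 (sameHalf⇒≡⊎adjacent x x′ e))

    crossLayer : ∀ {x x′ y y′} → deg pathP3 y ≢ deg pathP3 y′ → y ≢ y′ → x ≢ x′ →
      δadj G (combine x y) (combine x′ y′) ≡ false
    crossLayer {x} {x′} {y} {y′} d y≢y′ x≢x′ = δadj-diffDeg-nonadjacent G
      (λ e → d (+-cancelˡ-≡ 2 _ _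
        (trans (sym (deg-cycleBoxP3 3≤n x y)) (trans e (deg-cycleBoxP3 3≤n x′ y′)))))
      (boxAdj-apart (cycleG n) pathP3 y≢y′ (cong (_∧ pathP3 y y′) (finEq-≢ x≢x′)))

    sameColour : ∀ x y x′ y′ → layerColour k y (half x) ≡ layerColour k y′ (half x′) →
      δadj G (combine x y) (combine x′ y′) ≡ false
    sameColour x 0F x′ 0F e = sameLayer 0F e
    sameColour x 1F x′ 1F e = sameLayer 1F (rotate-injective (half<k x) (half<k x′) e)
    sameColour x 2F x′ 2F e = sameLayer 2F (+-cancelˡ-≡ k _ _ e)
    sameColour x 0F x′ 1F e = crossLayer (λ ()) (λ ()) λ x≡x′ →
      rotate-≢ (half x′) (⌈n/2⌉-mono 3≤n) (trans (sym e) (cong half x≡x′))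
    sameColour x 1F x′ 0F e = crossLayer (λ ()) (λ ()) λ x≡x′ →
      rotate-≢ (half x) (⌈n/2⌉-mono 3≤n) (trans e (cong half (sym x≡x′)))
    sameColour x 0F x′ 2F e = contradiction (subst (_< k) e (half<k x)) (m+n≮m k _)
    sameColour x 2F x′ 0F e = contradiction (subst (_< k) (sym e) (half<k x′)) (m+n≮m k _)
    sameColour x 1F x′ 2F e = contradiction (subst (_< k) e (rotate-< (half<k x))) (m+n≮m k _)
    sameColour x 2F x′ 1F e = contradiction (subst (_< k) (sym e) (rotate-< (half<k x′))) (m+n≮m k _)

  cycleBoxP3-δColouring : ProperColouring (n * 3) (δadj (cycleBoxP3 n)) (2 * ⌈ n /2⌉)
  cycleBoxP3-δColouring = colouring-from (uncurry colour ∘ remQuot 3) (∀-combine λ x y x′ y′ same →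
    sameColour x y x′ y′ (fromℕ<-injective _ _ _ _ (begin
      colour x y                                 ≡⟨ cong (uncurry colour) (remQuot-combine x y) ⟨
      uncurry colour (remQuot 3 (combine x y))   ≡⟨ same ⟩
      uncurry colour (remQuot 3 (combine x′ y′)) ≡⟨ cong (uncurry colour) (remQuot-combine x′ y′) ⟩
      colour x′ y′                               ∎)))
    where open ≡-Reasoning

cycleBoxP3-δColours≥ : ∀ {n m} → 4 ≤ n → ProperColouring (n * 3) (δadj (cycleBoxP3 n)) m → 2 * ⌈ n /2⌉ ≤ m
cycleBoxP3-δColours≥ {n} {m} 4≤n (c , proper) = subst (_≤ m) (cong (k +_) (sym (+-identityʳ k)))
  (disjoint-injections⇒≤ (proj₂ (layerRainbow 0F)) (proj₂ (layerRainbow 2F)) (λ i j → across _ _))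
  where
  k : ℕ
  k = ⌈ n /2⌉
  G : Adj (n * 3)
  G = cycleBoxP3 n
  3≤n : 3 ≤ n
  3≤n = ≤-trans (n≤1+n 3) 4≤n
  withinLayer : ∀ y x x′ → x ≢ x′ → cycleG n x x′ ≡ false → c (combine x y) ≢ c (combine x′ y)
  withinLayer y x x′ x≢x′ nonadjacent = proper _ _
    (δadj-sameDeg-nonadjacent G (deg-cycleBoxP3-cong 3≤n x y x′ y refl)
      (x≢x′ ∘ combine-injectiveˡ x y x′ y)
      (trans (boxAdj-sameLayer (cycleG n) pathP3 pathP3-irrefl x x′ y) nonadjacent))
  layerRainbow : ∀ y → Σ[ s ∈ (Fin k → Fin n) ] Injective _≡_ _≡_ (λ i → c (combine (s i) y))
  layerRainbow y = cycleComplement-rainbow 4≤n (λ x → c (combine x y)) (withinLayer y)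
  across : ∀ x x′ → c (combine x 0F) ≢ c (combine x′ 2F)
  across x x′ = proper _ _ (δadj-sameDeg-nonadjacent G (deg-cycleBoxP3-cong 3≤n x 0F x′ 2F refl)
    ((λ ()) ∘ combine-injectiveʳ x 0F x′ 2F)
    (boxAdj-apart (cycleG n) pathP3 (λ ()) (∧-zeroʳ (finEq x x′))))

mainTheorem9 : ∀ (n : ℕ) → 5 ≤ n →
    IsDeltaChromaticNumber n (cycleG n) ⌈ n /2⌉ ×
    IsDeltaChromaticNumber (n * 3) (cycleBoxP3 n) (2 * ⌈ n /2⌉)
mainTheorem9 n 5≤n =
  (cycleG-δColouring 3≤n , λ _ → cycleG-δColours≥ 4≤n) ,
  (cycleBoxP3-δColouring 3≤n , λ _ → cycleBoxP3-δColours≥ 4≤n)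
  where
  4≤n : 4 ≤ n
  4≤n = ≤-trans (n≤1+n 4) 5≤n
  3≤n : 3 ≤ n
  3≤n = ≤-trans (n≤1+n 3) 4≤n
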